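{- Let $n\ge 0$ and $k\ge 1$ be integers, and let $T$ be the triangle with vertices $(F_n,F_{n+k})$, $(F_{n+2k},F_{n+3k})$, $(F_{n+4k},F_{n+5k})$. Then the area of $T$ equals $\dfrac{5F_k^4L_k}{2}$ if $k$ is even, and $\dfrac{F_k^2L_k^3}{2}$ if $k$ is odd.
   Context: $F_n$ denotes the Fibonacci numbers ($F_0=0$, $F_1=1$, $F_{n+1}=F_n+F_{n-1}$) and $L_n$ the Lucas numbers ($L_0=2$, $L_1=1$, $L_{n+1}=L_n+L_{n-1}$). The area of the triangle with vertices $(x_1,y_1),(x_2,y_2),(x_3,y_3)$ is $\frac12\left|(x_2-x_1)(y_3-y_1)-(x_3-x_1)(y_2-y_1)\right|$. -}

module Defs where

open import Data.Nat using (ℕ; zero; suc; _+_)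
open import Data.Integer as ℤ using (ℤ; +_; _-_; _*_; ∣_∣)
open import Data.Product using (_×_; _,_)

F : ℕ → ℕ
F zero = 0
F (suc zero) = 1
F (suc (suc n)) = F (suc n) + F n

L : ℕ → ℕ
L zero = 2
L (suc zero) = 1
L (suc (suc n)) = L (suc n) + L n

Point : Set
Point = ℤ × ℤ

twiceArea : Point → Point → Point → ℕ
twiceArea (x1 , y1) (x2 , y2) (x3 , y3) =
  ∣ (x2 - x1) * (y3 - y1) - (x3 - x1) * (y2 - y1) ∣

module Submission where

-- Write u j = F (n + j k).  The addition formula F (m + k) = F (k - 1) F m + F k F (m + 1) and Cassini's
-- identity give the recurrence u (j + 2) = ℓ u (j + 1) - ε u j with ℓ = L k and ε = (-1)^k, and the invariant
-- u 1 ^ 2 - ℓ u 0 u 1 + ε u 0 ^ 2 = (-1)^n F k ^ 2.  The vertices are P, C²P, C⁴P for the companion matrix C of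
-- the recurrence, so twice the signed area is ℓ (ℓ² - (1 + ε)²) times that invariant, since det (C² - 1) =
-- (1 + ε)² - ℓ².  Finally L k ^ 2 = 5 F k ^ 2 + 4 ε turns ℓ² - (1 + ε)² into 5 F k ^ 2 for even k and into
-- L k ^ 2 for odd k.

open import Defs
open import Data.Nat.Base as ℕ using (ℕ; zero; suc)
open import Data.Product using (_,_; _×_)
open import Relation.Binary.PropositionalEquality using (_≡_; refl; sym; trans; cong; cong₂; module ≡-Reasoning)

module _ where
  open import Data.Nat.Base using (_+_; _*_)
  open import Data.Nat.Tactic.RingSolver using (solve-∀)

  F-+ : ∀ m k → F (m + suc k) ≡ F k * F m + F (suc k) * F (suc m)
  F-+ zero          k = base (F k) (F (suc k))
    where base : ∀ c d → d ≡ c * 0 + d * 1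
          base = solve-∀
  F-+ (suc zero)    k = base (F k) (F (suc k))
    where base : ∀ c d → d + c ≡ c * 1 + d * 1
          base = solve-∀
  F-+ (suc (suc m)) k = trans (cong₂ _+_ (F-+ (suc m) k) (F-+ m k)) (step (F k) (F (suc k)) (F m) (F (suc m)))
    where step : ∀ c d a b → (c * b + d * (b + a)) + (c * a + d * b) ≡ c * (b + a) + d * ((b + a) + b)
          step = solve-∀

  L≡2F+F : ∀ k → L (suc k) ≡ 2 * F k + F (suc k)
  L≡2F+F zero          = refl
  L≡2F+F (suc zero)    = refl
  L≡2F+F (suc (suc k)) = trans (cong₂ _+_ (L≡2F+F (suc k)) (L≡2F+F k)) (step (F k) (F (suc k)))
    where step : ∀ a b → (2 * b + (b + a)) + (2 * a + b) ≡ 2 * (b + a) + ((b + a) + b)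
          step = solve-∀

  n+2k≡n+k+k : ∀ n k → n + 2 * k ≡ n + k + k
  n+2k≡n+k+k = solve-∀

  n+[1+j]k≡n+jk+k : ∀ n j k → n + suc j * k ≡ n + j * k + k
  n+[1+j]k≡n+jk+k = solve-∀

module _ where
  open import Data.Integer.Base using (ℤ; +_; -_; _+_; _-_; _*_; _^_; -1ℤ; 1ℤ; ∣_∣)
  open import Data.Integer.Properties
    using (pos-+; pos-*; *-assoc; *-identityˡ; ^-distribˡ-+-*; -1*i≡-i; neg-involutive; ∣-i∣≡∣i∣)
  open import Data.Integer.Tactic.RingSolver using (solve-∀)
  open ≡-Reasoning

  -1^-periodic : ∀ m → -1ℤ ^ suc (suc m) ≡ -1ℤ ^ m
  -1^-periodic m = trans (^-distribˡ-+-* -1ℤ 2 m) (*-identityˡ (-1ℤ ^ m))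

  -1^even : ∀ m → m ℕ.% 2 ≡ 0 → -1ℤ ^ m ≡ 1ℤ
  -1^even zero          _ = refl
  -1^even (suc (suc m)) h = trans (-1^-periodic m) (-1^even m h)

  -1^odd : ∀ m → m ℕ.% 2 ≡ 1 → -1ℤ ^ m ≡ -1ℤ
  -1^odd (suc zero)    _ = refl
  -1^odd (suc (suc m)) h = trans (-1^-periodic m) (-1^odd m h)

  ∣-1^n*i∣≡∣i∣ : ∀ n i → ∣ -1ℤ ^ n * i ∣ ≡ ∣ i ∣
  ∣-1^n*i∣≡∣i∣ zero    i = cong ∣_∣ (*-identityˡ i)
  ∣-1^n*i∣≡∣i∣ (suc n) i = begin
      ∣ -1ℤ * -1ℤ ^ n * i ∣    ≡⟨ cong ∣_∣ (trans (*-assoc -1ℤ (-1ℤ ^ n) i) (-1*i≡-i (-1ℤ ^ n * i))) ⟩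
      ∣ - (-1ℤ ^ n * i) ∣      ≡⟨ ∣-i∣≡∣i∣ (-1ℤ ^ n * i) ⟩
      ∣ -1ℤ ^ n * i ∣          ≡⟨ ∣-1^n*i∣≡∣i∣ n i ⟩
      ∣ i ∣                    ∎

  pos-^ : ∀ m n → + (m ℕ.^ n) ≡ (+ m) ^ n
  pos-^ m zero    = refl
  pos-^ m (suc n) = trans (pos-* m (m ℕ.^ n)) (cong (+ m *_) (pos-^ m n))

  det : Point → Point → Point → ℤ
  det (x₁ , y₁) (x₂ , y₂) (x₃ , y₃) = (x₂ - x₁) * (y₃ - y₁) - (x₃ - x₁) * (y₂ - y₁)

  recurrence-det : ∀ {ℓ ε u₀ u₁ u₂ u₃ u₄ u₅ : ℤ} →
    u₂ ≡ ℓ * u₁ - ε * u₀ → u₃ ≡ ℓ * u₂ - ε * u₁ →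
    u₄ ≡ ℓ * u₃ - ε * u₂ → u₅ ≡ ℓ * u₄ - ε * u₃ →
    det (u₀ , u₁) (u₂ , u₃) (u₄ , u₅)
      ≡ ℓ * (ℓ * ℓ - (1ℤ + ε) * (1ℤ + ε)) * (u₁ * u₁ - ℓ * u₀ * u₁ + ε * u₀ * u₀)
  recurrence-det {ℓ} {ε} {u₀} {u₁} refl refl refl refl = identity ℓ ε u₀ u₁
    where
    identity : ∀ ℓ ε x y →
      let u₂ = ℓ * y - ε * x ; u₃ = ℓ * u₂ - ε * y ; u₄ = ℓ * u₃ - ε * u₂ ; u₅ = ℓ * u₄ - ε * u₃ in
      (u₂ - x) * (u₅ - y) - (u₄ - x) * (u₃ - y)
        ≡ ℓ * (ℓ * ℓ - (1ℤ + ε) * (1ℤ + ε)) * (y * y - ℓ * x * y + ε * x * x)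
    identity = solve-∀

  Fℤ Lℤ : ℕ → ℤ
  Fℤ n = + F n
  Lℤ n = + L n

  Fℤ-rec : ∀ m → Fℤ (suc (suc m)) ≡ Fℤ (suc m) + Fℤ m
  Fℤ-rec m = pos-+ (F (suc m)) (F m)

  Fℤ-+ : ∀ m k → Fℤ (m ℕ.+ suc k) ≡ Fℤ k * Fℤ m + Fℤ (suc k) * Fℤ (suc m)
  Fℤ-+ m k = trans (cong +_ (F-+ m k))
    (trans (pos-+ (F k ℕ.* F m) _) (cong₂ _+_ (pos-* (F k) (F m)) (pos-* (F (suc k)) (F (suc m)))))

  Lℤ≡2Fℤ+Fℤ : ∀ k → Lℤ (suc k) ≡ + 2 * Fℤ k + Fℤ (suc k)
  Lℤ≡2Fℤ+Fℤ k = trans (cong +_ (L≡2F+F k))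
    (trans (pos-+ (2 ℕ.* F k) (F (suc k))) (cong (_+ Fℤ (suc k)) (pos-* 2 (F k))))

  cassini : ∀ m → Fℤ m * (Fℤ (suc m) + Fℤ m) - Fℤ (suc m) * Fℤ (suc m) ≡ -1ℤ ^ suc m
  cassini zero    = refl
  cassini (suc m) = begin
      b * (Fℤ (suc (suc m)) + b) - Fℤ (suc (suc m)) * Fℤ (suc (suc m))
    ≡⟨ cong (λ x → b * (x + b) - x * x) (Fℤ-rec m) ⟩
      b * ((b + a) + b) - (b + a) * (b + a)
    ≡⟨ swap a b ⟩
      - (a * (b + a) - b * b)
    ≡⟨ cong -_ (cassini m) ⟩
      - (-1ℤ ^ suc m)
    ≡⟨ -1*i≡-i _ ⟨
      -1ℤ ^ suc (suc m)
    ∎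
    where
    a b : ℤ
    a = Fℤ m
    b = Fℤ (suc m)
    swap : ∀ a b → b * ((b + a) + b) - (b + a) * (b + a) ≡ - (a * (b + a) - b * b)
    swap = solve-∀

  lucas-square : ∀ k → Lℤ k * Lℤ k ≡ + 5 * (Fℤ k * Fℤ k) + + 4 * -1ℤ ^ k
  lucas-square zero    = refl
  lucas-square (suc k) = begin
      Lℤ (suc k) * Lℤ (suc k)
    ≡⟨ cong (λ l → l * l) (Lℤ≡2Fℤ+Fℤ k) ⟩
      (+ 2 * c + d) * (+ 2 * c + d)
    ≡⟨ expand c d ⟩
      + 5 * (d * d) + + 4 * (c * (d + c) - d * d)
    ≡⟨ cong (λ e → + 5 * (d * d) + + 4 * e) (cassini k) ⟩
      + 5 * (d * d) + + 4 * -1ℤ ^ suc k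
    ∎
    where
    c d : ℤ
    c = Fℤ k
    d = Fℤ (suc k)
    expand : ∀ c d → (+ 2 * c + d) * (+ 2 * c + d) ≡ + 5 * (d * d) + + 4 * (c * (d + c) - d * d)
    expand = solve-∀

  fib-stride-recurrence : ∀ m k → let K = suc k in
    Fℤ (m ℕ.+ K ℕ.+ K) ≡ Lℤ K * Fℤ (m ℕ.+ K) - -1ℤ ^ K * Fℤ m
  fib-stride-recurrence m k = begin
      Fℤ (m ℕ.+ K ℕ.+ K)
    ≡⟨ Fℤ-+ (m ℕ.+ K) k ⟩
      c * Fℤ (m ℕ.+ K) + d * Fℤ (suc m ℕ.+ K)
    ≡⟨ cong₂ (λ x y → c * x + d * y) (Fℤ-+ m k)
             (trans (Fℤ-+ (suc m) k) (cong (λ z → c * b + d * z) (Fℤ-rec m))) ⟩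
      c * (c * a + d * b) + d * (c * b + d * (b + a))
    ≡⟨ cayley-hamilton c d a b ⟩
      (+ 2 * c + d) * (c * a + d * b) - (c * (d + c) - d * d) * a
    ≡⟨ cong₂ (λ l e → l * (c * a + d * b) - e * a) (sym (Lℤ≡2Fℤ+Fℤ k)) (cassini k) ⟩
      Lℤ K * (c * a + d * b) - -1ℤ ^ K * a
    ≡⟨ cong (λ x → Lℤ K * x - -1ℤ ^ K * a) (Fℤ-+ m k) ⟨
      Lℤ K * Fℤ (m ℕ.+ K) - -1ℤ ^ K * a
    ∎
    where
    K : ℕ
    K = suc k
    a b c d : ℤ
    a = Fℤ m
    b = Fℤ (suc m)
    c = Fℤ k
    d = Fℤ (suc k)
    cayley-hamilton : ∀ c d a b →
      c * (c * a + d * b) + d * (c * b + d * (b + a)) ≡ (+ 2 * c + d) * (c * a + d * b) - (c * (d + c) - d * d) * a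
    cayley-hamilton = solve-∀

  fib-stride-invariant : ∀ n k → let K = suc k ; u = Fℤ (n ℕ.+ K) in
    u * u - Lℤ K * Fℤ n * u + -1ℤ ^ K * Fℤ n * Fℤ n ≡ -1ℤ ^ n * (Fℤ K * Fℤ K)
  fib-stride-invariant n k = begin
      u * u - Lℤ K * a * u + -1ℤ ^ K * a * a
    ≡⟨ cong₂ (λ l e → u * u - l * a * u + e * a * a) (Lℤ≡2Fℤ+Fℤ k) (sym (cassini k)) ⟩
      u * u - (+ 2 * c + d) * a * u + (c * (d + c) - d * d) * a * a
    ≡⟨ cong (λ x → x * x - (+ 2 * c + d) * a * x + (c * (d + c) - d * d) * a * a) (Fℤ-+ n k) ⟩
      (c * a + d * b) * (c * a + d * b) - (+ 2 * c + d) * a * (c * a + d * b) + (c * (d + c) - d * d) * a * a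
    ≡⟨ factor c d a b ⟩
      - (a * (b + a) - b * b) * (d * d)
    ≡⟨ cong (λ e → - e * (d * d)) (cassini n) ⟩
      - (-1ℤ ^ suc n) * (d * d)
    ≡⟨ cong (_* (d * d)) (trans (cong -_ (-1*i≡-i (-1ℤ ^ n))) (neg-involutive (-1ℤ ^ n))) ⟩
      -1ℤ ^ n * (d * d)
    ∎
    where
    K : ℕ
    K = suc k
    u a b c d : ℤ
    u = Fℤ (n ℕ.+ K)
    a = Fℤ n
    b = Fℤ (suc n)
    c = Fℤ k
    d = Fℤ (suc k)
    factor : ∀ c d a b →
      (c * a + d * b) * (c * a + d * b) - (+ 2 * c + d) * a * (c * a + d * b) + (c * (d + c) - d * d) * a * a
        ≡ - (a * (b + a) - b * b) * (d * d)
    factor = solve-∀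

  Δ : ℕ → ℤ
  Δ k = Fℤ k * Fℤ k * (Lℤ k * (Lℤ k * Lℤ k - (1ℤ + -1ℤ ^ k) * (1ℤ + -1ℤ ^ k)))

  fib-triangle-det : ∀ n k → let K = suc k in
    det (Fℤ n , Fℤ (n ℕ.+ K)) (Fℤ (n ℕ.+ 2 ℕ.* K) , Fℤ (n ℕ.+ 3 ℕ.* K)) (Fℤ (n ℕ.+ 4 ℕ.* K) , Fℤ (n ℕ.+ 5 ℕ.* K))
      ≡ -1ℤ ^ n * Δ K
  fib-triangle-det n k = begin
      det (Fℤ n , Fℤ (n ℕ.+ K)) (Fℤ (n ℕ.+ 2 ℕ.* K) , Fℤ (n ℕ.+ 3 ℕ.* K)) (Fℤ (n ℕ.+ 4 ℕ.* K) , Fℤ (n ℕ.+ 5 ℕ.* K))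
    ≡⟨ recurrence-det {ℓ} {ε} (recurrence-at n refl idx₂)
                              (recurrence-at (n ℕ.+ K) idx₂ (idx 2))
                              (recurrence-at (n ℕ.+ 2 ℕ.* K) (idx 2) (idx 3))
                              (recurrence-at (n ℕ.+ 3 ℕ.* K) (idx 3) (idx 4)) ⟩
      ℓ * (ℓ * ℓ - (1ℤ + ε) * (1ℤ + ε)) * (Fℤ (n ℕ.+ K) * Fℤ (n ℕ.+ K) - ℓ * Fℤ n * Fℤ (n ℕ.+ K) + ε * Fℤ n * Fℤ n)
    ≡⟨ cong (ℓ * (ℓ * ℓ - (1ℤ + ε) * (1ℤ + ε)) *_) (fib-stride-invariant n k) ⟩
      ℓ * (ℓ * ℓ - (1ℤ + ε) * (1ℤ + ε)) * (-1ℤ ^ n * (Fℤ K * Fℤ K))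
    ≡⟨ rearrange _ (-1ℤ ^ n) (Fℤ K * Fℤ K) ⟩
      -1ℤ ^ n * Δ K
    ∎
    where
    K : ℕ
    K = suc k
    ℓ ε : ℤ
    ℓ = Lℤ K
    ε = -1ℤ ^ K
    recurrence-at : ∀ m {i j} → i ≡ m ℕ.+ K → j ≡ i ℕ.+ K → Fℤ j ≡ ℓ * Fℤ i - ε * Fℤ m
    recurrence-at m refl refl = fib-stride-recurrence m k
    idx₂ : n ℕ.+ 2 ℕ.* K ≡ n ℕ.+ K ℕ.+ K
    idx₂ = n+2k≡n+k+k n K
    idx : ∀ j → n ℕ.+ suc j ℕ.* K ≡ n ℕ.+ j ℕ.* K ℕ.+ K
    idx j = n+[1+j]k≡n+jk+k n j K
    rearrange : ∀ x s y → x * (s * y) ≡ s * (y * x)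
    rearrange = solve-∀

  fib-triangle-twiceArea : ∀ n k → let K = suc k in
    twiceArea (Fℤ n , Fℤ (n ℕ.+ K)) (Fℤ (n ℕ.+ 2 ℕ.* K) , Fℤ (n ℕ.+ 3 ℕ.* K)) (Fℤ (n ℕ.+ 4 ℕ.* K) , Fℤ (n ℕ.+ 5 ℕ.* K))
      ≡ ∣ Δ K ∣
  fib-triangle-twiceArea n k = trans (cong ∣_∣ (fib-triangle-det n k)) (∣-1^n*i∣≡∣i∣ n (Δ (suc k)))

  Δ-even : ∀ k → k ℕ.% 2 ≡ 0 → Δ k ≡ + (5 ℕ.* F k ℕ.^ 4 ℕ.* L k)
  Δ-even k even = begin
      Δ k
    ≡⟨ cong (λ e → d * d * (ℓ * (ℓ * ℓ - (1ℤ + e) * (1ℤ + e)))) ε≡1 ⟩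
      d * d * (ℓ * (ℓ * ℓ - + 4))
    ≡⟨ cong (λ s → d * d * (ℓ * (s - + 4))) ℓ²≡5d²+4 ⟩
      d * d * (ℓ * (+ 5 * (d * d) + + 4 - + 4))
    ≡⟨ simplify d ℓ ⟩
      + 5 * d ^ 4 * ℓ
    ≡⟨ cast ⟨
      + (5 ℕ.* F k ℕ.^ 4 ℕ.* L k)
    ∎
    where
    d ℓ : ℤ
    d = Fℤ k
    ℓ = Lℤ k
    ε≡1 : -1ℤ ^ k ≡ 1ℤ
    ε≡1 = -1^even k even
    ℓ²≡5d²+4 : ℓ * ℓ ≡ + 5 * (d * d) + + 4
    ℓ²≡5d²+4 = trans (lucas-square k) (cong (λ e → + 5 * (d * d) + + 4 * e) ε≡1)
    cast : + (5 ℕ.* F k ℕ.^ 4 ℕ.* L k) ≡ + 5 * d ^ 4 * ℓ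
    cast = trans (pos-* (5 ℕ.* F k ℕ.^ 4) (L k))
                 (cong (_* ℓ) (trans (pos-* 5 (F k ℕ.^ 4)) (cong (+ 5 *_) (pos-^ (F k) 4))))
    simplify : ∀ d ℓ → d * d * (ℓ * (+ 5 * (d * d) + + 4 - + 4)) ≡ + 5 * (d * (d * (d * (d * 1ℤ)))) * ℓ
    simplify = solve-∀

  Δ-odd : ∀ k → k ℕ.% 2 ≡ 1 → Δ k ≡ + (F k ℕ.^ 2 ℕ.* L k ℕ.^ 3)
  Δ-odd k odd = begin
      Δ k
    ≡⟨ cong (λ e → d * d * (ℓ * (ℓ * ℓ - (1ℤ + e) * (1ℤ + e)))) (-1^odd k odd) ⟩
      d * d * (ℓ * (ℓ * ℓ - + 0))
    ≡⟨ simplify d ℓ ⟩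
      d ^ 2 * ℓ ^ 3
    ≡⟨ cast ⟨
      + (F k ℕ.^ 2 ℕ.* L k ℕ.^ 3)
    ∎
    where
    d ℓ : ℤ
    d = Fℤ k
    ℓ = Lℤ k
    cast : + (F k ℕ.^ 2 ℕ.* L k ℕ.^ 3) ≡ d ^ 2 * ℓ ^ 3
    cast = trans (pos-* (F k ℕ.^ 2) (L k ℕ.^ 3)) (cong₂ _*_ (pos-^ (F k) 2) (pos-^ (L k) 3))
    simplify : ∀ d ℓ → d * d * (ℓ * (ℓ * ℓ - + 0)) ≡ d * (d * 1ℤ) * (ℓ * (ℓ * (ℓ * 1ℤ)))
    simplify = solve-∀

open import Data.Nat using (_+_; _*_; _^_; _≥_; _%_)
open import Data.Integer using (+_; ∣_∣)

theorem2p1 : (n k : ℕ) → k ≥ 1 →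
    (k % 2 ≡ 0 → twiceArea (+ F n , + F (n + k)) (+ F (n + 2 * k) , + F (n + 3 * k)) (+ F (n + 4 * k) , + F (n + 5 * k)) ≡ 5 * F k ^ 4 * L k)
    × (k % 2 ≡ 1 → twiceArea (+ F n , + F (n + k)) (+ F (n + 2 * k) , + F (n + 3 * k)) (+ F (n + 4 * k) , + F (n + 5 * k)) ≡ F k ^ 2 * L k ^ 3)
theorem2p1 n (suc k) _ =
    (λ even → trans (fib-triangle-twiceArea n k) (cong ∣_∣ (Δ-even (suc k) even)))
  , (λ odd  → trans (fib-triangle-twiceArea n k) (cong ∣_∣ (Δ-odd (suc k) odd)))
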